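{- Let a finite group $\Gamma$ act on a finite set $X$ and run the Construction described below (with any choices of the sets $X'_{i+1}$). Then the Construction terminates after finitely many iterations, and if it performs $k-1$ iterations then the resulting labelling $\phi:X\to\{1,\dots,k\}$ is a $k$-distinguishing labelling of $X$ under the action of $\Gamma$.
   Context: For a group $H$ acting on a set $Y$, write $h.y$ for the action, $H.y$ for the orbit, and $\mathrm{Stab}_H(Z)=\{h\in H: h.z=z \text{ for all } z\in Z\}$. A labelling $\phi:Y\to\{1,\dots,k\}$ is $k$-distinguishing if $\{h\in H:\phi(h.y)=\phi(y)\text{ for all }y\}=\mathrm{Stab}_H(Y)$. Construction: (1) Set $i=1$, $\phi(x)=1$ for all $x\in X$, $\Gamma_1=\Gamma$, $X_1=X$. (2) While some element of $\Gamma_i$ moves some element of $X_i$: (a) choose a subset $X'_{i+1}\subseteq X_i$ containing exactly one element from each $\Gamma_i$-orbit in $X_i$ having at least two elements (and no other elements); (b) set $\phi(x)=i+1$ for each $x\in X'_{i+1}$; (c) set $X_{i+1}=X_i\setminus X'_{i+1}$ and $\Gamma_{i+1}=\mathrm{Stab}_{\Gamma_i}(X'_{i+1})$; (d) increase $i$ by $1$. -}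

module Defs where

open import Level using (Level; _⊔_) renaming (suc to lsuc)
open import Algebra.Bundles using (Group)
open import Data.Nat using (ℕ; zero; suc; _≤_)
open import Data.Fin using (Fin)
open import Data.Fin.Subset using (Subset; _∈_; _∉_)
open import Data.Vec using (lookup)
open import Data.Bool using (if_then_else_)
open import Data.List using (List; []; _∷_; length)
open import Data.Product using (Σ; ∃; _×_)
open import Data.Unit using (⊤)
open import Relation.Binary.PropositionalEquality using (_≡_; _≢_)
open import Function.Bundles using (_⇔_)

IsFiniteGroup : ∀ {c ℓ} → Group c ℓ → Set (c ⊔ ℓ)
IsFiniteGroup G = Σ ℕ λ m → Σ (Fin m → Carrier) λ enum → ∀ g → ∃ λ i → enum i ≈ g
  where open Group G

record Action {c ℓ} (G : Group c ℓ) (n : ℕ) : Set (c ⊔ ℓ) where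
  open Group G
  field
    act    : Carrier → Fin n → Fin n
    act-cong : ∀ {g h} x → g ≈ h → act g x ≡ act h x
    act-ε  : ∀ x → act ε x ≡ x
    act-∙  : ∀ g h x → act (g ∙ h) x ≡ act g (act h x)

module Construction {c ℓ} {G : Group c ℓ} {n : ℕ} (A : Action G n) where
  open Group G
  open Action A

  -- A history is the list of chosen sets X'_{i+1}, MOST RECENT FIRST:
  -- after i-1 iterations the history is  X'_i ∷ ... ∷ X'_2 ∷ [].

  -- Γ_i : Γ_1 = Γ, Γ_{i+1} = Stab_{Γ_i}(X'_{i+1})
  InΓ : List (Subset n) → Carrier → Set
  InΓ [] g = ⊤
  InΓ (X' ∷ H) g = InΓ H g × (∀ x → x ∈ X' → act g x ≡ x)

  -- X_i : X_1 = X, X_{i+1} = X_i ∖ X'_{i+1}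
  InX : List (Subset n) → Fin n → Set
  InX [] x = ⊤
  InX (X' ∷ H) x = InX H x × x ∉ X'

  -- loop condition: some element of Γ_i moves some element of X_i
  Moves : List (Subset n) → Set c
  Moves H = ∃ λ g → InΓ H g × ∃ λ x → InX H x × act g x ≢ x

  InOrbit : List (Subset n) → Fin n → Fin n → Set c
  InOrbit H x y = ∃ λ g → InΓ H g × act g x ≡ y

  NontrivialOrbit : List (Subset n) → Fin n → Set c
  NontrivialOrbit H x = ∃ λ y → InOrbit H x y × y ≢ x

  ValidChoice : List (Subset n) → Subset n → Set c
  ValidChoice H X' =
    (∀ x → x ∈ X' → InX H x × NontrivialOrbit H x) ×
    (∀ x → InX H x → NontrivialOrbit H x →
       ∃ λ y → y ∈ X' × InOrbit H x y × (∀ z → z ∈ X' → InOrbit H x z → z ≡ y))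

  data Reachable : List (Subset n) → Set c where
    start : Reachable []
    step  : ∀ {H X'} → Reachable H → Moves H → ValidChoice H X' → Reachable (X' ∷ H)

  -- the labelling φ : φ(x) = i+1 if x ∈ X'_{i+1}, and 1 otherwise
  label : List (Subset n) → Fin n → ℕ
  label [] x = 1
  label (X' ∷ H) x = if lookup X' x then suc (suc (length H)) else label H x

  Distinguishing : ℕ → (Fin n → ℕ) → Set c
  Distinguishing k φ =
    (∀ x → 1 ≤ φ x × φ x ≤ k) ×
    (∀ g → (∀ y → φ (act g y) ≡ φ y) ⇔ (∀ y → act g y ≡ y))

{-# OPTIONS --safe #-}
-- Each iteration removes from X_i the nonempty set X'_{i+1}, so there are at most |X|
-- iterations.  Valid choices exist: take the least point of every nontrivial orbit, which
-- is decidable because Γ is finite.  The chosen set X'_{i+1} is exactly the set of points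
-- carrying the maximal label i+1, so a label-preserving g maps X'_{i+1} into itself and,
-- by induction, lies in Γ_i; as the Γ_i-orbit of x ∈ X'_{i+1} meets X'_{i+1} only in x, g
-- fixes X'_{i+1}, i.e. g ∈ Γ_{i+1}.  When the loop stops, Γ_k fixes X_k pointwise, and it
-- fixes the points outside X_k by construction.
module Submission where

open import Defs
open import Algebra.Bundles using (Group)
open import Data.Bool using (true; false)
open import Data.Empty using (⊥-elim)
open import Data.Fin using (Fin; Fin′; zero; suc; inject; compare; less; equal; greater)
open import Data.Fin.Properties using (_≟_; all?; any?; ¬∀⟶∃¬-smallest)
open import Data.Fin.Subset using (Subset; _∈_; _∉_; ⊤; _─_; ∣_∣)
open import Data.Fin.Subset.Properties
  using (_∈?_; ∈⊤; ∣p∣≤n; x∈p∧x∉q⇒x∈p─q; x∈p∩q⁺; p∩q≢∅⇒∣p─q∣<∣p∣)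
open import Data.List using (List; []; _∷_; length)
open import Data.Nat using (ℕ; suc; _+_; _≤_; _<_; z≤n; s≤s)
import Data.Nat.Properties as ℕ
open import Data.Product using (∃; _×_; _,_; proj₁; proj₂)
open import Data.Unit using (tt)
open import Data.Vec using (tabulate; lookup; here; there)
open import Data.Vec.Properties using ([]=⇒lookup; lookup⇒[]=)
open import Function using (_∘_)
open import Function.Bundles using (mk⇔)
open import Relation.Nullary using (¬_; yes; no; does)
open import Relation.Nullary.Decidable using (_×-dec_; ¬?; _→-dec_; map′; decidable-stable)
open import Relation.Unary using (Pred; Decidable)
open import Relation.Binary.PropositionalEquality
  using (_≡_; refl; sym; trans; cong; module ≡-Reasoning)

fromDecidable : ∀ {n p} {P : Pred (Fin n) p} → Decidable P → Subset n
fromDecidable P? = tabulate (does ∘ P?)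

∈fromDecidable⁺ : ∀ {n p} {P : Pred (Fin n) p} (P? : Decidable P) {x} → P x → x ∈ fromDecidable P?
∈fromDecidable⁺ {suc n} P? {zero} px with P? zero
... | yes _ = here
... | no ¬px = ⊥-elim (¬px px)
∈fromDecidable⁺ {suc n} P? {suc x} px = there (∈fromDecidable⁺ (P? ∘ suc) px)

∈fromDecidable⁻ : ∀ {n p} {P : Pred (Fin n) p} (P? : Decidable P) {x} → x ∈ fromDecidable P? → P x
∈fromDecidable⁻ {suc n} P? {zero} x∈ with P? zero | x∈
... | yes px | _  = px
... | no _   | ()
∈fromDecidable⁻ {suc n} P? {suc x} (there x∈) = ∈fromDecidable⁻ (P? ∘ suc) x∈

least-witness : ∀ {n p} {P : Pred (Fin n) p} → Decidable P → ∀ {x} → P x →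
  ∃ λ y → P y × ((j : Fin′ y) → ¬ P (inject j))
least-witness {n} {P = P} P? {x} px with ¬∀⟶∃¬-smallest n (¬_ ∘ P) (¬? ∘ P?) (λ none → none x px)
... | y , ¬¬py , least = y , decidable-stable (P? y) ¬¬py , least

module _ {c ℓ} {G : Group c ℓ} {n : ℕ} (A : Action G n) where
  open Group G using (Carrier; _≈_; _∙_; ε; _⁻¹; inverseˡ) renaming (sym to ≈-sym)
  open Action A
  open Construction A

  act-inverseˡ : ∀ g x → act (g ⁻¹) (act g x) ≡ x
  act-inverseˡ g x = begin
    act (g ⁻¹) (act g x) ≡⟨ sym (act-∙ (g ⁻¹) g x) ⟩
    act (g ⁻¹ ∙ g) x     ≡⟨ act-cong x (inverseˡ g) ⟩
    act ε x              ≡⟨ act-ε x ⟩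
    x                    ∎
    where open ≡-Reasoning

  InΓ-resp-≈ : ∀ H {g h} → g ≈ h → InΓ H g → InΓ H h
  InΓ-resp-≈ []       g≈h _            = tt
  InΓ-resp-≈ (X' ∷ H) g≈h (gΓ , fixes) =
    InΓ-resp-≈ H g≈h gΓ , λ x x∈ → trans (sym (act-cong x g≈h)) (fixes x x∈)

  InΓ-ε : ∀ H → InΓ H ε
  InΓ-ε []       = tt
  InΓ-ε (X' ∷ H) = InΓ-ε H , λ x _ → act-ε x

  InΓ-⁻¹ : ∀ H {g} → InΓ H g → InΓ H (g ⁻¹)
  InΓ-⁻¹ []       _            = tt
  InΓ-⁻¹ (X' ∷ H) {g} (gΓ , fixes) =
    InΓ-⁻¹ H gΓ , λ x x∈ → trans (cong (act (g ⁻¹)) (sym (fixes x x∈))) (act-inverseˡ g x)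

  InΓ-∙ : ∀ H {g h} → InΓ H g → InΓ H h → InΓ H (g ∙ h)
  InΓ-∙ []       _ _ = tt
  InΓ-∙ (X' ∷ H) {g} {h} (gΓ , g-fixes) (hΓ , h-fixes) =
    InΓ-∙ H gΓ hΓ , λ x x∈ → trans (act-∙ g h x) (trans (cong (act g) (h-fixes x x∈)) (g-fixes x x∈))

  InOrbit-refl : ∀ H x → InOrbit H x x
  InOrbit-refl H x = ε , InΓ-ε H , act-ε x

  InOrbit-sym : ∀ H {x y} → InOrbit H x y → InOrbit H y x
  InOrbit-sym H {x} (g , gΓ , refl) = g ⁻¹ , InΓ-⁻¹ H gΓ , act-inverseˡ g x

  InOrbit-trans : ∀ H {x y z} → InOrbit H x y → InOrbit H y z → InOrbit H x z
  InOrbit-trans H {x} (g , gΓ , refl) (h , hΓ , refl) = h ∙ g , InΓ-∙ H hΓ gΓ , act-∙ h g x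

  NontrivialOrbit-resp : ∀ H {x y} → InOrbit H x y → NontrivialOrbit H x → NontrivialOrbit H y
  NontrivialOrbit-resp H {x} {y} oxy ntx with x ≟ y
  ... | yes refl = ntx
  ... | no x≢y   = x , InOrbit-sym H oxy , x≢y

  InΓ-fixes-∉X : ∀ H {g y} → InΓ H g → ¬ InX H y → act g y ≡ y
  InΓ-fixes-∉X []       _            y∉X = ⊥-elim (y∉X tt)
  InΓ-fixes-∉X (X' ∷ H) {y = y} (gΓ , fixes) y∉X with y ∈? X'
  ... | yes y∈ = fixes y y∈
  ... | no y∉  = InΓ-fixes-∉X H gΓ (λ y∈X → y∉X (y∈X , y∉))

  ValidChoice-unique : ∀ {H X' x y} → ValidChoice H X' → x ∈ X' → y ∈ X' → InOrbit H x y → y ≡ x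
  ValidChoice-unique {H} {x = x} (chosen , meets) x∈ y∈ oxy with chosen x x∈
  ... | x∈X , ntx with meets x x∈X ntx
  ... | _ , _ , _ , unique = trans (unique _ y∈ oxy) (sym (unique x x∈ (InOrbit-refl H x)))

  Moves⇒chosen : ∀ {H X'} → Moves H → ValidChoice H X' → ∃ λ y → InX H y × y ∈ X'
  Moves⇒chosen (g , gΓ , x , x∈X , gx≢x) (chosen , meets)
    with meets x x∈X (act g x , (g , gΓ , refl) , gx≢x)
  ... | y , y∈ , _ = y , proj₁ (chosen y y∈) , y∈

  -- X_i as a Subset n, so that its size can be counted.
  remaining : List (Subset n) → Subset n
  remaining []       = ⊤
  remaining (X' ∷ H) = remaining H ─ X'

  InX⇒∈remaining : ∀ H {x} → InX H x → x ∈ remaining H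
  InX⇒∈remaining []       _           = ∈⊤
  InX⇒∈remaining (X' ∷ H) (x∈X , x∉) = x∈p∧x∉q⇒x∈p─q (InX⇒∈remaining H x∈X) x∉

  length+∣remaining∣≤n : ∀ {H} → Reachable H → length H + ∣ remaining H ∣ ≤ n
  length+∣remaining∣≤n start = ∣p∣≤n ⊤
  length+∣remaining∣≤n {X' ∷ H} (step r mv vc) with Moves⇒chosen mv vc
  ... | y , y∈X , y∈ = begin
    suc (length H) + ∣ remaining H ─ X' ∣ ≡⟨ sym (ℕ.+-suc (length H) _) ⟩
    length H + suc ∣ remaining H ─ X' ∣   ≤⟨ ℕ.+-monoʳ-≤ (length H) shrinks ⟩
    length H + ∣ remaining H ∣            ≤⟨ length+∣remaining∣≤n r ⟩
    n                                     ∎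
    where
    open ℕ.≤-Reasoning
    shrinks : ∣ remaining H ─ X' ∣ < ∣ remaining H ∣
    shrinks = p∩q≢∅⇒∣p─q∣<∣p∣ _ _ (y , x∈p∩q⁺ (InX⇒∈remaining H y∈X , y∈))

  length≤n : ∀ {H} → Reachable H → length H ≤ n
  length≤n {H} r = ℕ.≤-trans (ℕ.m≤m+n (length H) _) (length+∣remaining∣≤n r)

  1≤label : ∀ H x → 1 ≤ label H x
  1≤label []       x = ℕ.≤-refl
  1≤label (X' ∷ H) x with lookup X' x
  ... | true  = s≤s z≤n
  ... | false = 1≤label H x

  label≤1+length : ∀ H x → label H x ≤ suc (length H)
  label≤1+length []       x = ℕ.≤-refl
  label≤1+length (X' ∷ H) x with lookup X' x
  ... | true  = ℕ.≤-refl
  ... | false = ℕ.m≤n⇒m≤1+n (label≤1+length H x)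

  label-∈ : ∀ {X'} H {x} → x ∈ X' → label (X' ∷ H) x ≡ suc (suc (length H))
  label-∈ _ x∈ rewrite []=⇒lookup x∈ = refl

  label-∉ : ∀ {X'} H {x} → x ∉ X' → label (X' ∷ H) x ≡ label H x
  label-∉ {X'} _ {x} x∉ with lookup X' x in eq
  ... | true  = ⊥-elim (x∉ (lookup⇒[]= x X' eq))
  ... | false = refl

  InX⇒label≡1 : ∀ H {x} → InX H x → label H x ≡ 1
  InX⇒label≡1 []       _           = refl
  InX⇒label≡1 (X' ∷ H) (x∈X , x∉) = trans (label-∉ H x∉) (InX⇒label≡1 H x∈X)

  label≡top⇒∈ : ∀ {X'} H {x} → label (X' ∷ H) x ≡ suc (suc (length H)) → x ∈ X'
  label≡top⇒∈ {X'} H {x} eq with x ∈? X'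
  ... | yes x∈ = x∈
  ... | no x∉  = ⊥-elim (ℕ.<-irrefl (trans (sym (label-∉ H x∉)) eq) (s≤s (label≤1+length H x)))

  Preserves : (Fin n → ℕ) → Carrier → Set
  Preserves φ g = ∀ y → φ (act g y) ≡ φ y

  module _ {X'} H {g} (preserves : Preserves (label (X' ∷ H)) g) where

    preserves-∈ : ∀ {x} → x ∈ X' → act g x ∈ X'
    preserves-∈ {x} x∈ = label≡top⇒∈ H (trans (preserves x) (label-∈ H x∈))

    preserves-∉ : ∀ {x} → x ∉ X' → act g x ∉ X'
    preserves-∉ {x} x∉ gx∈ = x∉ (label≡top⇒∈ H (trans (sym (preserves x)) (label-∈ H gx∈)))

    preserves-tail : (∀ x → x ∈ X' → InX H x) → Preserves (label H) g
    preserves-tail X'⊆X y with y ∈? X'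
    ... | yes y∈ = trans (InX⇒label≡1 H (X'⊆X _ (preserves-∈ y∈))) (sym (InX⇒label≡1 H (X'⊆X y y∈)))
    ... | no y∉  = begin
      label H (act g y)        ≡⟨ sym (label-∉ H (preserves-∉ y∉)) ⟩
      label (X' ∷ H) (act g y) ≡⟨ preserves y ⟩
      label (X' ∷ H) y         ≡⟨ label-∉ H y∉ ⟩
      label H y                ∎
      where open ≡-Reasoning

  Preserves⇒InΓ : ∀ {H g} → Reachable H → Preserves (label H) g → InΓ H g
  Preserves⇒InΓ start _ = tt
  Preserves⇒InΓ {X' ∷ H} {g} (step r _ vc@(chosen , _)) preserves = gΓ , fixes
    where
    gΓ : InΓ H g
    gΓ = Preserves⇒InΓ r (preserves-tail H preserves (λ x x∈ → proj₁ (chosen x x∈)))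
    fixes : ∀ x → x ∈ X' → act g x ≡ x
    fixes x x∈ = ValidChoice-unique vc x∈ (preserves-∈ H preserves x∈) (g , gΓ , refl)

  terminal-label-distinguishing : ∀ {H} → Reachable H → ¬ Moves H →
    Distinguishing (suc (length H)) (label H)
  terminal-label-distinguishing {H} r stopped =
    (λ x → 1≤label H x , label≤1+length H x) , λ g → mk⇔ (fixes g) (λ fix y → cong (label H) (fix y))
    where
    fixes : ∀ g → Preserves (label H) g → ∀ y → act g y ≡ y
    fixes g preserves y = decidable-stable (act g y ≟ y) λ moved →
      moved (InΓ-fixes-∉X H gΓ (λ y∈X → stopped (g , gΓ , y , y∈X , moved)))
      where gΓ = Preserves⇒InΓ r preserves

  IsLeastRepresentative : List (Subset n) → Pred (Fin n) c
  IsLeastRepresentative H y =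
    InX H y × NontrivialOrbit H y × ((j : Fin′ y) → InX H (inject j) → ¬ InOrbit H y (inject j))

  least-representative-unique : ∀ H {x y} → IsLeastRepresentative H x → IsLeastRepresentative H y →
    InOrbit H x y → x ≡ y
  least-representative-unique H {x} {y} (x∈X , _ , x-least) (y∈X , _ , y-least) oxy with compare x y
  ... | less    _ j = ⊥-elim (y-least j x∈X (InOrbit-sym H oxy))
  ... | equal   _   = refl
  ... | greater _ j = ⊥-elim (x-least j y∈X oxy)

  module _ (finite : IsFiniteGroup G) where
    private
      enum = proj₁ (proj₂ finite)
      enum-surjective = proj₂ (proj₂ finite)

    InΓ? : ∀ H → Decidable (InΓ H)
    InΓ? []       g = yes tt
    InΓ? (X' ∷ H) g = InΓ? H g ×-dec all? (λ x → x ∈? X' →-dec act g x ≟ x)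

    InX? : ∀ H → Decidable (InX H)
    InX? []       x = yes tt
    InX? (X' ∷ H) x = InX? H x ×-dec ¬? (x ∈? X')

    InOrbit? : ∀ H x → Decidable (InOrbit H x)
    InOrbit? H x y = map′ to from (any? λ i → InΓ? H (enum i) ×-dec act (enum i) x ≟ y)
      where
      to : (∃ λ i → InΓ H (enum i) × act (enum i) x ≡ y) → InOrbit H x y
      to (i , iΓ , ix≡y) = enum i , iΓ , ix≡y
      from : InOrbit H x y → ∃ λ i → InΓ H (enum i) × act (enum i) x ≡ y
      from (g , gΓ , gx≡y) with enum-surjective g
      ... | i , i≈g = i , InΓ-resp-≈ H (≈-sym i≈g) gΓ , trans (act-cong x i≈g) gx≡y

    NontrivialOrbit? : ∀ H → Decidable (NontrivialOrbit H)
    NontrivialOrbit? H x = any? λ y → InOrbit? H x y ×-dec ¬? (y ≟ x)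

    IsLeastRepresentative? : ∀ H → Decidable (IsLeastRepresentative H)
    IsLeastRepresentative? H y =
      InX? H y ×-dec NontrivialOrbit? H y ×-dec
      all? (λ j → InX? H (inject j) →-dec ¬? (InOrbit? H y (inject j)))

    least-representative-exists : ∀ H {x} → InX H x → NontrivialOrbit H x →
      ∃ λ y → IsLeastRepresentative H y × InOrbit H x y
    least-representative-exists H {x} x∈X ntx
      with least-witness (λ z → InX? H z ×-dec InOrbit? H x z) (x∈X , InOrbit-refl H x)
    ... | y , (y∈X , oxy) , least =
      y , (y∈X , NontrivialOrbit-resp H oxy ntx , λ j j∈X oyj → least j (j∈X , InOrbit-trans H oxy oyj)) , oxy

    leastRepresentatives : List (Subset n) → Subset n
    leastRepresentatives H = fromDecidable (IsLeastRepresentative? H)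

    leastRepresentatives-valid : ∀ H → ValidChoice H (leastRepresentatives H)
    leastRepresentatives-valid H = chosen , meets
      where
      representative : ∀ {x} → x ∈ leastRepresentatives H → IsLeastRepresentative H x
      representative = ∈fromDecidable⁻ (IsLeastRepresentative? H)
      chosen : ∀ x → x ∈ leastRepresentatives H → InX H x × NontrivialOrbit H x
      chosen x x∈ with representative x∈
      ... | x∈X , ntx , _ = x∈X , ntx
      meets : ∀ x → InX H x → NontrivialOrbit H x → ∃ λ y → y ∈ leastRepresentatives H × InOrbit H x y ×
        (∀ z → z ∈ leastRepresentatives H → InOrbit H x z → z ≡ y)
      meets x x∈X ntx with least-representative-exists H x∈X ntx
      ... | y , y-rep , oxy =
        y , ∈fromDecidable⁺ (IsLeastRepresentative? H) y-rep , oxy ,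
        λ z z∈ oxz → least-representative-unique H (representative z∈) y-rep
                       (InOrbit-trans H (InOrbit-sym H oxz) oxy)

proposition2p8 : ∀ {c ℓ} (G : Group c ℓ) → IsFiniteGroup G → (n : ℕ) (A : Action G n) →
    let open Construction A in
      ((∃ λ N → ∀ H → Reachable H → length H ≤ N) ×
       (∀ H → Reachable H → Moves H → ∃ λ X' → ValidChoice H X')) ×
      (∀ H → Reachable H → ¬ Moves H → Distinguishing (suc (length H)) (label H))
proposition2p8 G finite n A =
  ((n , λ _ → length≤n A) ,
   (λ H _ _ → leastRepresentatives A finite H , leastRepresentatives-valid A finite H)) ,
  λ _ → terminal-label-distinguishing A
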